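{- Let $C_1,C_2,C_3$ be cycles of odd length in a graph with $|C_1|\equiv|C_2|\equiv|C_3|\pmod 4$, such that any two of them intersect exactly in a common vertex $x$. Let $y\notin V(C_1)\cup V(C_2)\cup V(C_3)$ be a vertex and, for $i=1,2,3$, let $P_i$ be a path from $y$ to a vertex of $C_i$ other than $x$, such that the internal vertices of $P_1,P_2,P_3$ avoid $C_1,C_2,C_3$ and $P_1,P_2,P_3$ are pairwise internally-disjoint. Then $C_1\cup C_2\cup C_3\cup P_1\cup P_2\cup P_3$ contains a cycle whose length is divisible by $4$.
   Context: Graphs are finite and simple; lengths count edges. -}

module Defs where

open import Data.Nat using (ℕ; suc; _≤_)
open import Data.Fin using (Fin)
open import Data.List using (List; []; _∷_; _++_; [_]; length)
open import Data.List.Relation.Unary.Linked using (Linked)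
open import Data.List.Relation.Unary.Unique.Propositional using (Unique)
open import Data.List.Membership.Propositional using (_∈_)
open import Relation.Binary.PropositionalEquality using (_≡_)
open import Relation.Nullary using (¬_)

record Graph (n : ℕ) : Set₁ where
  field
    Adj    : Fin n → Fin n → Set
    sym    : ∀ {u v} → Adj u v → Adj v u
    irrefl : ∀ {v} → ¬ Adj v v

module _ {A : Set} where
  data EdgeIn : List A → A → A → Set where
    fwd   : ∀ {a b xs} → EdgeIn (a ∷ b ∷ xs) a b
    bwd   : ∀ {a b xs} → EdgeIn (a ∷ b ∷ xs) b a
    there : ∀ {x xs u v} → EdgeIn xs u v → EdgeIn (x ∷ xs) u v

module _ {n : ℕ} (G : Graph n) where
  open Graph G

  record Cycle : Set where
    field
      start    : Fin n
      rest     : List (Fin n)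
      distinct : Unique (start ∷ rest)
      long     : 2 ≤ length rest
      closed   : Linked Adj (start ∷ rest ++ [ start ])

  -- A path from u to v (u ≠ v) given by its list of internal vertices:
  -- vertex sequence u , inner , v, all distinct, consecutive ones adjacent.
  record Path (u v : Fin n) : Set where
    field
      inner    : List (Fin n)
      distinct : Unique (u ∷ inner ++ [ v ])
      linked   : Linked Adj (u ∷ inner ++ [ v ])

module _ {n : ℕ} {G : Graph n} where
  -- number of edges (= number of vertices) of a cycle
  len : Cycle G → ℕ
  len C = suc (length (Cycle.rest C))

  _∈C_ : Fin n → Cycle G → Set
  v ∈C C = v ∈ (Cycle.start C ∷ Cycle.rest C)

  EdgeC : Cycle G → Fin n → Fin n → Set
  EdgeC C = EdgeIn (Cycle.start C ∷ Cycle.rest C ++ [ Cycle.start C ])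

  _∈int_ : ∀ {u w} → Fin n → Path G u w → Set
  v ∈int P = v ∈ Path.inner P

  EdgeP : ∀ {u w} → Path G u w → Fin n → Fin n → Set
  EdgeP {u} {w} P = EdgeIn (u ∷ Path.inner P ++ [ w ])

{-# OPTIONS --safe #-}
-- For each i, x and zᵢ cut Cᵢ into two x–zᵢ arcs whose lengths add up to the odd number |Cᵢ|.
-- Prolonging both arcs by Pᵢ gives two y–x paths whose lengths have odd sum, so one of them,
-- Rᵢ, has even length. Of three even numbers two are congruent modulo 4, so 4 divides some
-- |Rᵢ| + |Rⱼ|, and Rᵢ ∪ Rⱼ is a cycle since the hypotheses make Rᵢ and Rⱼ internally disjoint.
module Submission where

open import Defs
open import Data.Nat using (ℕ; zero; suc; _+_; _*_; _%_; _≤_; parity)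
open import Data.Nat.Properties using (≤-pred; <⇒≤; *-distribʳ-+)
open import Data.Nat.Divisibility using (_∣_; divides; ∣-refl; ∣m∣n⇒∣m+n; *-monoˡ-∣; ∣⇒≤)
open import Data.Parity.Base as ℙ using (0ℙ; 1ℙ)
open import Data.Parity.Properties using (+-homo-+)
open import Data.Fin using (Fin)
open import Data.Product using (Σ; Σ-syntax; ∃-syntax; _×_; _,_; proj₁; proj₂)
open import Data.Sum using (_⊎_; inj₁; inj₂; swap)
import Data.Sum as Sum
open import Data.Empty using (⊥-elim)
open import Function using (_∘_)
open import Data.List using (List; []; _∷_; _++_; [_]; length; reverse)
open import Data.List.Properties using (++-assoc; length-++; length-reverse; unfold-reverse; reverse-++)
open import Data.List.Relation.Unary.Linked using (Linked; []; [-]; _∷_)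
open import Data.List.Relation.Unary.AllPairs using ([]; _∷_)
open import Data.List.Relation.Unary.All as All using ([])
import Data.List.Relation.Unary.All.Properties as All
open import Data.List.Relation.Unary.Any using (here; there)
open import Data.List.Relation.Unary.Any.Properties using (reverse⁻)
open import Data.List.Relation.Unary.Unique.Propositional using (Unique)
open import Data.List.Relation.Unary.Unique.Propositional.Properties using (++⁺)
open import Data.List.Relation.Binary.Disjoint.Propositional using (Disjoint)
open import Data.List.Relation.Binary.Permutation.Propositional using (_↭_; ↭-refl; ↭-sym; ↭⇒↭ₛ)
open import Data.List.Relation.Binary.Permutation.Propositional.Properties
  using (++-comm; ↭-reverse; ↭-length; ∈-resp-↭)
import Data.List.Relation.Binary.Permutation.Setoid.Properties as Permutationₛ
open import Data.List.Membership.Propositional using (_∈_)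
open import Data.List.Membership.Propositional.Properties using (∈-++⁺ˡ; ∈-++⁺ʳ; ∈-++⁻; ∈-∃++)
open import Relation.Binary.Core using (_⇒_)
open import Relation.Binary.Definitions using (Symmetric)
open import Relation.Binary.Construct.Union using (_∪_)
open import Relation.Binary.PropositionalEquality
  using (_≡_; _≢_; refl; sym; trans; cong; subst; setoid; module ≡-Reasoning)
open import Relation.Nullary using (¬_)

module _ {A : Set} where

  Unique-resp-↭ : ∀ {xs ys : List A} → xs ↭ ys → Unique xs → Unique ys
  Unique-resp-↭ = Permutationₛ.Unique-resp-↭ (setoid A) ∘ ↭⇒↭ₛ

  Unique-reverse : ∀ {xs : List A} → Unique xs → Unique (reverse xs)
  Unique-reverse {xs} = Unique-resp-↭ (↭-sym (↭-reverse xs))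

  Unique-++⁻ : ∀ (xs : List A) {ys} → Unique (xs ++ ys) → Unique xs × Unique ys × Disjoint xs ys
  Unique-++⁻ []       u          = [] , u , λ { (() , _) }
  Unique-++⁻ (x ∷ xs) (x∉ ∷ u) with All.++⁻ xs x∉ | Unique-++⁻ xs u
  ... | x∉xs , x∉ys | uxs , uys , disj = x∉xs ∷ uxs , uys , λ where
    (here refl  , v∈ys) → All.lookup x∉ys v∈ys refl
    (there v∈xs , v∈ys) → disj (v∈xs , v∈ys)

  Unique-arcs⁻ : ∀ {u v : A} xs ys → Unique (u ∷ xs ++ v ∷ ys) →
                 Unique (u ∷ xs ++ [ v ]) × Unique (v ∷ ys ++ [ u ])
  Unique-arcs⁻ {u} {v} xs ys uniq with Unique-++⁻ (u ∷ xs) uniq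
  ... | uxs , uys , disj =
    ++⁺ uxs ([] ∷ []) (λ { (a∈ , here refl) → disj (a∈ , here refl) }) ,
    ++⁺ uys ([] ∷ []) (λ { (a∈ , here refl) → disj (here refl , a∈) })

  Unique-arcs⁺ : ∀ {u v : A} xs ys → Unique (u ∷ xs ++ [ v ]) → Unique (v ∷ ys ++ [ u ]) →
                 Disjoint xs ys → Unique (u ∷ xs ++ v ∷ ys)
  Unique-arcs⁺ {u} {v} xs ys uxsv uysv disj
    with Unique-++⁻ (u ∷ xs) uxsv | Unique-++⁻ (v ∷ ys) uysv
  ... | uxs , _ , v∉uxs | uys , _ , u∉vys = ++⁺ uxs uys λ where
    (here refl  , here refl)  → v∉uxs (here refl , here refl)
    (here refl  , there a∈ys) → u∉vys (there a∈ys , here refl)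
    (there a∈xs , here refl)  → v∉uxs (there a∈xs , here refl)
    (there a∈xs , there a∈ys) → disj (a∈xs , a∈ys)

  EdgeIn-++⁻ : ∀ (xs : List A) {w ys} → EdgeIn (xs ++ w ∷ ys) ⇒ EdgeIn (xs ++ [ w ]) ∪ EdgeIn (w ∷ ys)
  EdgeIn-++⁻ []           e         = inj₂ e
  EdgeIn-++⁻ (a ∷ [])     fwd       = inj₁ fwd
  EdgeIn-++⁻ (a ∷ [])     bwd       = inj₁ bwd
  EdgeIn-++⁻ (a ∷ b ∷ xs) fwd       = inj₁ fwd
  EdgeIn-++⁻ (a ∷ b ∷ xs) bwd       = inj₁ bwd
  EdgeIn-++⁻ (a ∷ xs)     (there e) = Sum.map₁ there (EdgeIn-++⁻ xs e)

  EdgeIn-++⁺ˡ : ∀ (xs : List A) {w ys} → EdgeIn (xs ++ [ w ]) ⇒ EdgeIn (xs ++ w ∷ ys)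
  EdgeIn-++⁺ˡ []           (there ())
  EdgeIn-++⁺ˡ (a ∷ [])     fwd       = fwd
  EdgeIn-++⁺ˡ (a ∷ [])     bwd       = bwd
  EdgeIn-++⁺ˡ (a ∷ b ∷ xs) fwd       = fwd
  EdgeIn-++⁺ˡ (a ∷ b ∷ xs) bwd       = bwd
  EdgeIn-++⁺ˡ (a ∷ xs)     (there e) = there (EdgeIn-++⁺ˡ xs e)

  EdgeIn-++⁺ʳ : ∀ (xs : List A) {ys} → EdgeIn ys ⇒ EdgeIn (xs ++ ys)
  EdgeIn-++⁺ʳ []       e = e
  EdgeIn-++⁺ʳ (a ∷ xs) e = there (EdgeIn-++⁺ʳ xs e)

  EdgeIn-join⁻ : ∀ (u : A) xs v ys w →
                 EdgeIn (u ∷ (xs ++ v ∷ ys) ++ [ w ]) ⇒ EdgeIn (u ∷ xs ++ [ v ]) ∪ EdgeIn (v ∷ ys ++ [ w ])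
  EdgeIn-join⁻ u xs v ys w rewrite ++-assoc xs (v ∷ ys) [ w ] = EdgeIn-++⁻ (u ∷ xs)

  EdgeIn-join⁺ : ∀ (u : A) xs v ys w →
                 EdgeIn (u ∷ xs ++ [ v ]) ∪ EdgeIn (v ∷ ys ++ [ w ]) ⇒ EdgeIn (u ∷ (xs ++ v ∷ ys) ++ [ w ])
  EdgeIn-join⁺ u xs v ys w rewrite ++-assoc xs (v ∷ ys) [ w ] =
    Sum.[ EdgeIn-++⁺ˡ (u ∷ xs) , EdgeIn-++⁺ʳ (u ∷ xs) ]

  reverse-∷-∷ : ∀ (a b : A) ws → reverse (a ∷ b ∷ ws) ≡ reverse ws ++ b ∷ [ a ]
  reverse-∷-∷ a b ws = begin
    reverse (a ∷ b ∷ ws)           ≡⟨ unfold-reverse a (b ∷ ws) ⟩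
    reverse (b ∷ ws) ++ [ a ]      ≡⟨ cong (_++ [ a ]) (unfold-reverse b ws) ⟩
    (reverse ws ++ [ b ]) ++ [ a ] ≡⟨ ++-assoc (reverse ws) [ b ] [ a ] ⟩
    reverse ws ++ b ∷ [ a ]        ∎
    where open ≡-Reasoning

  EdgeIn-reverse : ∀ (ws : List A) → EdgeIn (reverse ws) ⇒ EdgeIn ws
  EdgeIn-reverse []           ()
  EdgeIn-reverse (a ∷ [])     (there ())
  EdgeIn-reverse (a ∷ b ∷ ws) {u} {v} e =
    Sum.[ there ∘ EdgeIn-reverse (b ∷ ws) ∘ subst (λ l → EdgeIn l u v) (sym (unfold-reverse b ws))
        , last-edge ]
      (EdgeIn-++⁻ (reverse ws) (subst (λ l → EdgeIn l u v) (reverse-∷-∷ a b ws) e))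
    where
    last-edge : EdgeIn (b ∷ [ a ]) u v → EdgeIn (a ∷ b ∷ ws) u v
    last-edge fwd                = bwd
    last-edge bwd                = fwd
    last-edge (there (there ()))

  reverse-∷-++ : ∀ (u : A) ws v → reverse (u ∷ ws ++ [ v ]) ≡ v ∷ reverse ws ++ [ u ]
  reverse-∷-++ u ws v = begin
    reverse (u ∷ ws ++ [ v ])     ≡⟨ unfold-reverse u (ws ++ [ v ]) ⟩
    reverse (ws ++ [ v ]) ++ [ u ] ≡⟨ cong (_++ [ u ]) (reverse-++ ws [ v ]) ⟩
    v ∷ reverse ws ++ [ u ]       ∎
    where open ≡-Reasoning

  module _ {R : A → A → Set} where

    Linked⇒EdgeIn : Symmetric R → ∀ {ws} → Linked R ws → EdgeIn ws ⇒ R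
    Linked⇒EdgeIn R-sym (r ∷ _)  fwd       = r
    Linked⇒EdgeIn R-sym (r ∷ _)  bwd       = R-sym r
    Linked⇒EdgeIn R-sym (_ ∷ rs) (there e) = Linked⇒EdgeIn R-sym rs e
    Linked⇒EdgeIn R-sym [-]      (there ())

    EdgeIn⇒Linked : ∀ {ws} → EdgeIn ws ⇒ R → Linked R ws
    EdgeIn⇒Linked {[]}         _     = []
    EdgeIn⇒Linked {a ∷ []}     _     = [-]
    EdgeIn⇒Linked {a ∷ b ∷ ws} edges = edges fwd ∷ EdgeIn⇒Linked (edges ∘ there)

  rotate : ∀ {x : A} s r → x ∈ s ∷ r →
           ∃[ m ] (x ∷ m ↭ s ∷ r × EdgeIn (x ∷ m ++ [ x ]) ⇒ EdgeIn (s ∷ r ++ [ s ]))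
  rotate s r (here refl) = r , ↭-refl , λ e → e
  rotate {x} s r (there x∈r) with ∈-∃++ x∈r
  ... | p , q , refl =
    q ++ s ∷ p , ++-comm (x ∷ q) (s ∷ p) , EdgeIn-join⁺ s p x q s ∘ swap ∘ EdgeIn-join⁻ x q s p x

parity≡0ℙ⇒2∣ : ∀ n → parity n ≡ 0ℙ → 2 ∣ n
parity≡0ℙ⇒2∣ zero          _  = divides 0 refl
parity≡0ℙ⇒2∣ (suc (suc n)) eq = ∣m∣n⇒∣m+n (∣-refl {2}) (parity≡0ℙ⇒2∣ n eq)

n%2≡1⇒parity≡1ℙ : ∀ n → n % 2 ≡ 1 → parity n ≡ 1ℙ
n%2≡1⇒parity≡1ℙ (suc zero)    _  = refl
n%2≡1⇒parity≡1ℙ (suc (suc n)) eq = n%2≡1⇒parity≡1ℙ n eq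

parity-sum≡0ℙ⇒2∣ : ∀ m n → parity m ℙ.+ parity n ≡ 0ℙ → 2 ∣ m + n
parity-sum≡0ℙ⇒2∣ m n eq = parity≡0ℙ⇒2∣ (m + n) (trans (+-homo-+ m n) eq)

p+a≡0ℙ⊎p+b≡0ℙ : ∀ p a b → a ℙ.+ b ≡ 1ℙ → p ℙ.+ a ≡ 0ℙ ⊎ p ℙ.+ b ≡ 0ℙ
p+a≡0ℙ⊎p+b≡0ℙ 0ℙ 0ℙ _  _  = inj₁ refl
p+a≡0ℙ⊎p+b≡0ℙ 1ℙ 1ℙ _  _  = inj₁ refl
p+a≡0ℙ⊎p+b≡0ℙ 0ℙ 1ℙ 0ℙ _  = inj₂ refl
p+a≡0ℙ⊎p+b≡0ℙ 1ℙ 0ℙ 1ℙ _  = inj₂ refl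
p+a≡0ℙ⊎p+b≡0ℙ 0ℙ 1ℙ 1ℙ ()
p+a≡0ℙ⊎p+b≡0ℙ 1ℙ 0ℙ 0ℙ ()

Parity-pigeonhole : ∀ p q r → p ℙ.+ q ≡ 0ℙ ⊎ p ℙ.+ r ≡ 0ℙ ⊎ q ℙ.+ r ≡ 0ℙ
Parity-pigeonhole 0ℙ 0ℙ _  = inj₁ refl
Parity-pigeonhole 1ℙ 1ℙ _  = inj₁ refl
Parity-pigeonhole 0ℙ 1ℙ 0ℙ = inj₂ (inj₁ refl)
Parity-pigeonhole 1ℙ 0ℙ 1ℙ = inj₂ (inj₁ refl)
Parity-pigeonhole 0ℙ 1ℙ 1ℙ = inj₂ (inj₂ refl)
Parity-pigeonhole 1ℙ 0ℙ 0ℙ = inj₂ (inj₂ refl)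

even-summand : ∀ p a b → (a + b) % 2 ≡ 1 → 2 ∣ p + a ⊎ 2 ∣ p + b
even-summand p a b odd =
  Sum.map (parity-sum≡0ℙ⇒2∣ p a) (parity-sum≡0ℙ⇒2∣ p b)
    (p+a≡0ℙ⊎p+b≡0ℙ (parity p) (parity a) (parity b)
      (trans (sym (+-homo-+ a b)) (n%2≡1⇒parity≡1ℙ (a + b) odd)))

-- Write the even numbers as 2i, 2j, 2k: two of i, j, k have the same parity.
even-pigeonhole : ∀ {a b c} → 2 ∣ a → 2 ∣ b → 2 ∣ c → 4 ∣ a + b ⊎ 4 ∣ a + c ⊎ 4 ∣ b + c
even-pigeonhole (divides i refl) (divides j refl) (divides k refl) =
  Sum.map (twice i j) (Sum.map (twice i k) (twice j k))
    (Parity-pigeonhole (parity i) (parity j) (parity k))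
  where
  twice : ∀ i j → parity i ℙ.+ parity j ≡ 0ℙ → 4 ∣ i * 2 + j * 2
  twice i j eq = subst (4 ∣_) (*-distribʳ-+ 2 i j) (*-monoˡ-∣ 2 (parity-sum≡0ℙ⇒2∣ i j eq))

module _ {n : ℕ} {G : Graph n} where
  open Graph G renaming (sym to Adj-sym)

  lenP : ∀ {u v} → Path G u v → ℕ
  lenP P = suc (length (Path.inner P))

  EdgeP⇒Adj : ∀ {u v} (P : Path G u v) → EdgeP P ⇒ Adj
  EdgeP⇒Adj P = Linked⇒EdgeIn Adj-sym (Path.linked P)

  inner≢target : ∀ {u v w} (P : Path G u v) → w ∈int P → w ≢ v
  inner≢target P w∈P refl with Path.distinct P
  ... | _ ∷ distinct = proj₂ (proj₂ (Unique-++⁻ (Path.inner P) distinct)) (w∈P , here refl)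

  reversePath : ∀ {u v} → Path G u v → Path G v u
  reversePath {u} {v} P = record
    { inner    = reverse (Path.inner P)
    ; distinct = subst Unique (reverse-∷-++ u (Path.inner P) v) (Unique-reverse (Path.distinct P))
    ; linked   = subst (Linked Adj) (reverse-∷-++ u (Path.inner P) v)
                   (EdgeIn⇒Linked (EdgeP⇒Adj P ∘ EdgeIn-reverse _))
    }

  lenP-reversePath : ∀ {u v} (P : Path G u v) → lenP (reversePath P) ≡ lenP P
  lenP-reversePath P = cong suc (length-reverse (Path.inner P))

  EdgeP-reversePath : ∀ {u v} (P : Path G u v) → EdgeP (reversePath P) ⇒ EdgeP P
  EdgeP-reversePath {u} {v} P {a} {b} =
    EdgeIn-reverse _ ∘ subst (λ ws → EdgeIn ws a b) (sym (reverse-∷-++ u (Path.inner P) v))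

  ∈int-reversePath : ∀ {u v w} (P : Path G u v) → w ∈int reversePath P → w ∈int P
  ∈int-reversePath P = reverse⁻

  joinPath : ∀ {u v w} (P : Path G u v) (Q : Path G v w) →
             Disjoint (u ∷ Path.inner P) (Path.inner Q ++ [ w ]) → Path G u w
  joinPath {u} {v} {w} P Q disj = record
    { inner    = Path.inner P ++ v ∷ Path.inner Q
    ; distinct = subst Unique (sym walk) (++⁺ (proj₁ prefix) (Path.distinct Q) disj′)
    ; linked   = EdgeIn⇒Linked
                   (Sum.[ EdgeP⇒Adj P , EdgeP⇒Adj Q ] ∘ EdgeIn-join⁻ u (Path.inner P) v (Path.inner Q) w)
    }
    where
    walk : u ∷ (Path.inner P ++ v ∷ Path.inner Q) ++ [ w ] ≡ (u ∷ Path.inner P) ++ v ∷ Path.inner Q ++ [ w ]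
    walk = cong (u ∷_) (++-assoc (Path.inner P) (v ∷ Path.inner Q) [ w ])
    prefix : Unique (u ∷ Path.inner P) × Unique [ v ] × Disjoint (u ∷ Path.inner P) [ v ]
    prefix = Unique-++⁻ (u ∷ Path.inner P) (Path.distinct P)
    disj′ : Disjoint (u ∷ Path.inner P) (v ∷ Path.inner Q ++ [ w ])
    disj′ (a∈ , here refl) = proj₂ (proj₂ prefix) (a∈ , here refl)
    disj′ (a∈ , there a∈′) = disj (a∈ , a∈′)

  lenP-joinPath : ∀ {u v w} (P : Path G u v) (Q : Path G v w)
                  (d : Disjoint (u ∷ Path.inner P) (Path.inner Q ++ [ w ])) →
                  lenP (joinPath P Q d) ≡ lenP P + lenP Q
  lenP-joinPath P Q d = cong suc (length-++ (Path.inner P))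

  EdgeP-joinPath : ∀ {u v w} (P : Path G u v) (Q : Path G v w)
                   (d : Disjoint (u ∷ Path.inner P) (Path.inner Q ++ [ w ])) →
                   EdgeP (joinPath P Q d) ⇒ EdgeP P ∪ EdgeP Q
  EdgeP-joinPath {u} {v} {w} P Q d = EdgeIn-join⁻ u (Path.inner P) v (Path.inner Q) w

  closeCycle : ∀ {u v} (P : Path G u v) (Q : Path G v u) →
               Disjoint (Path.inner P) (Path.inner Q) → 3 ≤ lenP P + lenP Q → Cycle G
  closeCycle {u} {v} P Q disj 3≤ = record
    { start    = u
    ; rest     = Path.inner P ++ v ∷ Path.inner Q
    ; distinct = Unique-arcs⁺ (Path.inner P) (Path.inner Q) (Path.distinct P) (Path.distinct Q) disj
    ; long     = subst (2 ≤_) (sym (length-++ (Path.inner P))) (≤-pred 3≤)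
    ; closed   = EdgeIn⇒Linked
                   (Sum.[ EdgeP⇒Adj P , EdgeP⇒Adj Q ] ∘ EdgeIn-join⁻ u (Path.inner P) v (Path.inner Q) u)
    }

  len-closeCycle : ∀ {u v} (P : Path G u v) (Q : Path G v u)
                   (d : Disjoint (Path.inner P) (Path.inner Q)) (h : 3 ≤ lenP P + lenP Q) →
                   len (closeCycle P Q d h) ≡ lenP P + lenP Q
  len-closeCycle P Q d h = cong suc (length-++ (Path.inner P))

  EdgeC-closeCycle : ∀ {u v} (P : Path G u v) (Q : Path G v u)
                     (d : Disjoint (Path.inner P) (Path.inner Q)) (h : 3 ≤ lenP P + lenP Q) →
                     EdgeC (closeCycle P Q d h) ⇒ EdgeP P ∪ EdgeP Q
  EdgeC-closeCycle {u} {v} P Q d h = EdgeIn-join⁻ u (Path.inner P) v (Path.inner Q) u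

  record CycleSplit (C : Cycle G) (x z : Fin n) : Set where
    field
      out        : Path G x z
      back       : Path G z x
      length-sum : lenP out + lenP back ≡ len C
      edges⊆     : EdgeP out ∪ EdgeP back ⇒ EdgeC C
      inner⊆     : ∀ {v} → v ∈int out ⊎ v ∈int back → v ∈C C

  splitCycle : ∀ {x z} (C : Cycle G) → x ∈C C → z ∈C C → z ≢ x → CycleSplit C x z
  splitCycle {x} {z} C x∈C z∈C z≢x with rotate (Cycle.start C) (Cycle.rest C) x∈C
  ... | m , rotation , rotated⊆ with ∈-resp-↭ (↭-sym rotation) z∈C
  ... | here z≡x = ⊥-elim (z≢x z≡x)
  ... | there z∈m with ∈-∃++ z∈m
  ... | α , β , refl = record
    { out        = record { inner = α ; distinct = proj₁ arcs ; linked = EdgeIn⇒Linked (adjacent ∘ inj₁) }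
    ; back       = record { inner = β ; distinct = proj₂ arcs ; linked = EdgeIn⇒Linked (adjacent ∘ inj₂) }
    ; length-sum = trans (cong suc (sym (length-++ α))) (↭-length rotation)
    ; edges⊆     = rotated⊆ ∘ EdgeIn-join⁺ x α z β x
    ; inner⊆     = ∈-resp-↭ rotation ∘ there ∘ Sum.[ ∈-++⁺ˡ , ∈-++⁺ʳ α ∘ there ]
    }
    where
    arcs : Unique (x ∷ α ++ [ z ]) × Unique (z ∷ β ++ [ x ])
    arcs = Unique-arcs⁻ α β (Unique-resp-↭ (↭-sym rotation) (Cycle.distinct C))
    adjacent : EdgeIn (x ∷ α ++ [ z ]) ∪ EdgeIn (z ∷ β ++ [ x ]) ⇒ Adj
    adjacent = Linked⇒EdgeIn Adj-sym (Cycle.closed C) ∘ rotated⊆ ∘ EdgeIn-join⁺ x α z β x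

  record EvenRoute {y z} (P : Path G y z) (C : Cycle G) (x : Fin n) : Set where
    field
      path   : Path G y x
      even   : 2 ∣ lenP path
      edges⊆ : EdgeP path ⇒ EdgeP P ∪ EdgeC C
      inner⊆ : ∀ {v} → v ∈int path → v ∈int P ⊎ v ∈C C

  evenRoute : ∀ {x y z} (C : Cycle G) (P : Path G y z) → len C % 2 ≡ 1 → x ∈C C → z ∈C C → z ≢ x →
              ¬ y ∈C C → (∀ v → v ∈int P → ¬ v ∈C C) → EvenRoute P C x
  evenRoute {x} {y} {z} C P odd x∈C z∈C z≢x y∉C P∩C =
    Sum.[ through (reversePath out) (edges⊆ ∘ inj₁ ∘ EdgeP-reversePath out)
                                    (inner⊆ ∘ inj₁ ∘ ∈int-reversePath out)
            ∘ subst (λ k → 2 ∣ lenP P + k) (sym (lenP-reversePath out))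
        , through back (edges⊆ ∘ inj₂) (inner⊆ ∘ inj₂) ]
      (even-summand (lenP P) (lenP out) (lenP back) (subst (λ k → k % 2 ≡ 1) (sym length-sum) odd))
    where
    open CycleSplit (splitCycle C x∈C z∈C z≢x)

    through : (Q : Path G z x) → EdgeP Q ⇒ EdgeC C → (∀ {v} → v ∈int Q → v ∈C C) →
              2 ∣ lenP P + lenP Q → EvenRoute P C x
    through Q Q⊆C-edges Q⊆C even = record
      { path   = joinPath P Q disjoint
      ; even   = subst (2 ∣_) (sym (lenP-joinPath P Q disjoint)) even
      ; edges⊆ = Sum.map₂ Q⊆C-edges ∘ EdgeP-joinPath P Q disjoint
      ; inner⊆ = inner
      }
      where
      off-C : ∀ {v} → v ∈ y ∷ Path.inner P → ¬ v ∈C C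
      off-C (here refl) = y∉C
      off-C (there v∈P) = P∩C _ v∈P

      on-C : ∀ {v} → v ∈ Path.inner Q ++ [ x ] → v ∈C C
      on-C v∈ with ∈-++⁻ (Path.inner Q) v∈
      ... | inj₁ v∈Q         = Q⊆C v∈Q
      ... | inj₂ (here refl) = x∈C

      disjoint : Disjoint (y ∷ Path.inner P) (Path.inner Q ++ [ x ])
      disjoint (v∈yP , v∈Qx) = off-C v∈yP (on-C v∈Qx)

      inner : ∀ {v} → v ∈ Path.inner P ++ z ∷ Path.inner Q → v ∈int P ⊎ v ∈C C
      inner v∈ with ∈-++⁻ (Path.inner P) v∈
      ... | inj₁ v∈P         = inj₁ v∈P
      ... | inj₂ (here refl) = inj₂ z∈C
      ... | inj₂ (there v∈Q) = inj₂ (Q⊆C v∈Q)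

  EvenRoute-disjoint : ∀ {x y z z′} {P : Path G y z} {P′ : Path G y z′} {C C′ : Cycle G}
    (R : EvenRoute P C x) (R′ : EvenRoute P′ C′ x) →
    (∀ v → v ∈int P → ¬ v ∈int P′) → (∀ v → v ∈int P → ¬ v ∈C C′) → (∀ v → v ∈int P′ → ¬ v ∈C C) →
    (∀ v → v ∈C C → v ∈C C′ → v ≡ x) →
    Disjoint (Path.inner (EvenRoute.path R)) (Path.inner (EvenRoute.path R′))
  EvenRoute-disjoint R R′ P∩P′ P∩C′ P′∩C C∩C′ {v} (v∈R , v∈R′)
    with EvenRoute.inner⊆ R v∈R | EvenRoute.inner⊆ R′ v∈R′
  ... | inj₁ v∈P | inj₁ v∈P′ = P∩P′ v v∈P v∈P′
  ... | inj₁ v∈P | inj₂ v∈C′ = P∩C′ v v∈P v∈C′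
  ... | inj₂ v∈C | inj₁ v∈P′ = P′∩C v v∈P′ v∈C
  ... | inj₂ v∈C | inj₂ v∈C′ = inner≢target (EvenRoute.path R) v∈R (C∩C′ v v∈C v∈C′)

  FourCycleIn : (Fin n → Fin n → Set) → Set
  FourCycleIn T = Σ[ D ∈ Cycle G ] (EdgeC D ⇒ T) × 4 ∣ len D

  FourCycleIn-mono : ∀ {S T} → S ⇒ T → FourCycleIn S → FourCycleIn T
  FourCycleIn-mono S⇒T (D , edges , 4∣D) = D , S⇒T ∘ edges , 4∣D

  twoPathsCycle : ∀ {x y} (Q R : Path G y x) → Disjoint (Path.inner Q) (Path.inner R) →
                  4 ∣ lenP Q + lenP R → FourCycleIn (EdgeP Q ∪ EdgeP R)
  twoPathsCycle Q R disj 4∣ =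
    closeCycle Q (reversePath R) disj′ 3≤ ,
    Sum.map₂ (EdgeP-reversePath R) ∘ EdgeC-closeCycle Q (reversePath R) disj′ 3≤ ,
    subst (4 ∣_) (sym (trans (len-closeCycle Q (reversePath R) disj′ 3≤) lengths)) 4∣
    where
    lengths : lenP Q + lenP (reversePath R) ≡ lenP Q + lenP R
    lengths = cong (lenP Q +_) (lenP-reversePath R)
    disj′ : Disjoint (Path.inner Q) (Path.inner (reversePath R))
    disj′ (v∈Q , v∈R) = disj (v∈Q , ∈int-reversePath R v∈R)
    3≤ : 3 ≤ lenP Q + lenP (reversePath R)
    3≤ = subst (3 ≤_) (sym lengths) (<⇒≤ (∣⇒≤ 4∣))

  threeEvenPathsCycle : ∀ {x y} (R₁ R₂ R₃ : Path G y x) → 2 ∣ lenP R₁ → 2 ∣ lenP R₂ → 2 ∣ lenP R₃ →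
    Disjoint (Path.inner R₁) (Path.inner R₂) → Disjoint (Path.inner R₁) (Path.inner R₃) →
    Disjoint (Path.inner R₂) (Path.inner R₃) → FourCycleIn (EdgeP R₁ ∪ EdgeP R₂ ∪ EdgeP R₃)
  threeEvenPathsCycle R₁ R₂ R₃ e₁ e₂ e₃ d₁₂ d₁₃ d₂₃ with even-pigeonhole e₁ e₂ e₃
  ... | inj₁ 4∣        = FourCycleIn-mono Sum.[ inj₁ , inj₂ ∘ inj₁ ] (twoPathsCycle R₁ R₂ d₁₂ 4∣)
  ... | inj₂ (inj₁ 4∣) = FourCycleIn-mono Sum.[ inj₁ , inj₂ ∘ inj₂ ] (twoPathsCycle R₁ R₃ d₁₃ 4∣)
  ... | inj₂ (inj₂ 4∣) = FourCycleIn-mono (inj₂ ∘ Sum.[ inj₁ , inj₂ ]) (twoPathsCycle R₂ R₃ d₂₃ 4∣)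

lemma8 : ∀ {n} (G : Graph n) (C₁ C₂ C₃ : Cycle G) (x y z₁ z₂ z₃ : Fin n)
         (P₁ : Path G y z₁) (P₂ : Path G y z₂) (P₃ : Path G y z₃) →
         len C₁ % 2 ≡ 1 → len C₂ % 2 ≡ 1 → len C₃ % 2 ≡ 1 →
         len C₁ % 4 ≡ len C₂ % 4 → len C₂ % 4 ≡ len C₃ % 4 →
         x ∈C C₁ → x ∈C C₂ → x ∈C C₃ →
         (∀ v → v ∈C C₁ → v ∈C C₂ → v ≡ x) →
         (∀ v → v ∈C C₁ → v ∈C C₃ → v ≡ x) →
         (∀ v → v ∈C C₂ → v ∈C C₃ → v ≡ x) →
         ¬ y ∈C C₁ → ¬ y ∈C C₂ → ¬ y ∈C C₃ →
         z₁ ∈C C₁ → z₂ ∈C C₂ → z₃ ∈C C₃ →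
         z₁ ≢ x → z₂ ≢ x → z₃ ≢ x →
         (∀ v → v ∈int P₁ ⊎ v ∈int P₂ ⊎ v ∈int P₃ →
                ¬ v ∈C C₁ × ¬ v ∈C C₂ × ¬ v ∈C C₃) →
         (∀ v → v ∈int P₁ → ¬ v ∈int P₂) →
         (∀ v → v ∈int P₁ → ¬ v ∈int P₃) →
         (∀ v → v ∈int P₂ → ¬ v ∈int P₃) →
         Σ (Cycle G) λ D →
           (∀ u v → EdgeC D u v →
              EdgeC C₁ u v ⊎ EdgeC C₂ u v ⊎ EdgeC C₃ u v ⊎
              EdgeP P₁ u v ⊎ EdgeP P₂ u v ⊎ EdgeP P₃ u v)
           × 4 ∣ len D
lemma8 G C₁ C₂ C₃ x y z₁ z₂ z₃ P₁ P₂ P₃ odd₁ odd₂ odd₃ _ _ x∈C₁ x∈C₂ x∈C₃ C₁∩C₂ C₁∩C₃ C₂∩C₃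
       y∉C₁ y∉C₂ y∉C₃ z₁∈C₁ z₂∈C₂ z₃∈C₃ z₁≢x z₂≢x z₃≢x avoid P₁∩P₂ P₁∩P₃ P₂∩P₃ =
  let D , edges , 4∣D = FourCycleIn-mono (regroup ∘ Sum.map (edges⊆ R₁) (Sum.map (edges⊆ R₂) (edges⊆ R₃)))
                          (threeEvenPathsCycle (path R₁) (path R₂) (path R₃) (even R₁) (even R₂) (even R₃)
                             R₁∩R₂ R₁∩R₃ R₂∩R₃)
  in D , (λ _ _ → edges) , 4∣D
  where
  open EvenRoute
  R₁ : EvenRoute P₁ C₁ x
  R₁ = evenRoute C₁ P₁ odd₁ x∈C₁ z₁∈C₁ z₁≢x y∉C₁ (λ v → proj₁ ∘ avoid v ∘ inj₁)
  R₂ : EvenRoute P₂ C₂ x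
  R₂ = evenRoute C₂ P₂ odd₂ x∈C₂ z₂∈C₂ z₂≢x y∉C₂ (λ v → proj₁ ∘ proj₂ ∘ avoid v ∘ inj₂ ∘ inj₁)
  R₃ : EvenRoute P₃ C₃ x
  R₃ = evenRoute C₃ P₃ odd₃ x∈C₃ z₃∈C₃ z₃≢x y∉C₃ (λ v → proj₂ ∘ proj₂ ∘ avoid v ∘ inj₂ ∘ inj₂)
  R₁∩R₂ : Disjoint (Path.inner (path R₁)) (Path.inner (path R₂))
  R₁∩R₂ = EvenRoute-disjoint R₁ R₂ P₁∩P₂
            (λ v → proj₁ ∘ proj₂ ∘ avoid v ∘ inj₁) (λ v → proj₁ ∘ avoid v ∘ inj₂ ∘ inj₁) C₁∩C₂
  R₁∩R₃ : Disjoint (Path.inner (path R₁)) (Path.inner (path R₃))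
  R₁∩R₃ = EvenRoute-disjoint R₁ R₃ P₁∩P₃
            (λ v → proj₂ ∘ proj₂ ∘ avoid v ∘ inj₁) (λ v → proj₁ ∘ avoid v ∘ inj₂ ∘ inj₂) C₁∩C₃
  R₂∩R₃ : Disjoint (Path.inner (path R₂)) (Path.inner (path R₃))
  R₂∩R₃ = EvenRoute-disjoint R₂ R₃ P₂∩P₃
            (λ v → proj₂ ∘ proj₂ ∘ avoid v ∘ inj₂ ∘ inj₁) (λ v → proj₁ ∘ proj₂ ∘ avoid v ∘ inj₂ ∘ inj₂) C₂∩C₃
  regroup : ∀ {u v} → (EdgeP P₁ ∪ EdgeC C₁) u v ⊎ (EdgeP P₂ ∪ EdgeC C₂) u v ⊎ (EdgeP P₃ ∪ EdgeC C₃) u v →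
            EdgeC C₁ u v ⊎ EdgeC C₂ u v ⊎ EdgeC C₃ u v ⊎ EdgeP P₁ u v ⊎ EdgeP P₂ u v ⊎ EdgeP P₃ u v
  regroup (inj₁ (inj₁ e))        = inj₂ (inj₂ (inj₂ (inj₁ e)))
  regroup (inj₁ (inj₂ e))        = inj₁ e
  regroup (inj₂ (inj₁ (inj₁ e))) = inj₂ (inj₂ (inj₂ (inj₂ (inj₁ e))))
  regroup (inj₂ (inj₁ (inj₂ e))) = inj₂ (inj₁ e)
  regroup (inj₂ (inj₂ (inj₁ e))) = inj₂ (inj₂ (inj₂ (inj₂ (inj₂ e))))
  regroup (inj₂ (inj₂ (inj₂ e))) = inj₂ (inj₂ (inj₁ e))
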